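{- Let $\Gamma$ be a $G$-symmetric graph admitting a nontrivial $G$-invariant partition $\mathcal{B}$ such that $k = v - i$ for some integer $i \ge 1$. Then the multiplicity $m$ of $\mathcal{D}(B)$ (which equals that of $\overline{\mathcal{D}}(B)$) is a common divisor of $r$ and $b$.
   Context: For $G \le \mathrm{Aut}(\Gamma)$, $\Gamma$ is $G$-symmetric if $G$ is transitive on vertices and on arcs. A nontrivial $G$-invariant partition $\mathcal{B}$ of $V(\Gamma)$ is a partition with $1<|B|<|V(\Gamma)|$ and $B^g\in\mathcal{B}$ for all $B\in\mathcal{B}, g\in G$. The quotient graph $\Gamma_{\mathcal{B}}$ has vertex set $\mathcal{B}$, $B,C$ adjacent iff some edge of $\Gamma$ joins them; it is assumed to have at least one edge. $\Gamma(\alpha)$ is the neighbourhood of $\alpha$, $\Gamma(B)=\bigcup_{\alpha\in B}\Gamma(\alpha)$, $\Gamma_{\mathcal{B}}(\alpha)=\{C\in\mathcal{B}:\Gamma(\alpha)\cap C\ne\emptyset\}$, $\Gamma_{\mathcal{B}}(B)$ the neighbourhood of $B$ in $\Gamma_{\mathcal{B}}$. Parameters: $v=|B|$, $k=|B\cap\Gamma(C)|$ for adjacent $B,C$, $r=|\Gamma_{\mathcal{B}}(\alpha)|$, $b$ the valency of $\Gamma_{\mathcal{B}}$. $\mathcal{D}(B)$ is the incidence structure with point set $B$, block set $\Gamma_{\mathcal{B}}(B)$, $\alpha$ incident with $C$ iff $\alpha\in\Gamma(C)$; $\overline{\mathcal{D}}(B)$ is its complement ($\alpha$ incident with $C$ iff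 $\alpha\notin\Gamma(C)$). The multiplicity is $m = |\{D\in\Gamma_{\mathcal{B}}(B): \Gamma(D)\cap B = \Gamma(C)\cap B\}|$ for adjacent $B,C$ (independent of the choice). -}

module Defs where

open import Data.Nat using (ℕ; _+_; _<_; _≤_)
open import Data.Bool using (Bool; true; false; _∧_; _∨_; not; if_then_else_)
open import Data.Fin as F using (Fin)
import Data.Nat as ℕ
open import Data.Fin.Properties using (_≟_)
open import Data.Fin.Permutation using (Permutation′; _⟨$⟩ʳ_; _∘ₚ_; flip; id)
open import Data.Product using (Σ; _×_; ∃; _,_)
open import Relation.Nullary.Decidable using (⌊_⌋)
open import Relation.Binary.PropositionalEquality using (_≡_; _≢_)

count : ∀ {n} → (Fin n → Bool) → ℕ
count {ℕ.zero}  f = 0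
count {ℕ.suc n} f = (if f F.zero then 1 else 0) + count (λ i → f (F.suc i))

anyF : ∀ {n} → (Fin n → Bool) → Bool
anyF {ℕ.zero}  f = false
anyF {ℕ.suc n} f = f F.zero ∨ anyF (λ i → f (F.suc i))

allF : ∀ {n} → (Fin n → Bool) → Bool
allF {ℕ.zero}  f = true
allF {ℕ.suc n} f = f F.zero ∧ allF (λ i → f (F.suc i))

_==_ : ∀ {n} → Fin n → Fin n → Bool
i == j = ⌊ i ≟ j ⌋

_⇒ᵇ_ : Bool → Bool → Bool
a ⇒ᵇ b = not a ∨ b

_⇔ᵇ_ : Bool → Bool → Bool
a ⇔ᵇ b = (a ⇒ᵇ b) ∧ (b ⇒ᵇ a)

record Graph (n : ℕ) : Set where
  field
    adj   : Fin n → Fin n → Bool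
    sym   : ∀ x y → adj x y ≡ adj y x
    irrefl : ∀ x → adj x x ≡ false

record PermGroup (n : ℕ) : Set₁ where
  field
    mem     : Permutation′ n → Set
    id-mem  : mem id
    ∘-mem   : ∀ {g h} → mem g → mem h → mem (g ∘ₚ h)
    inv-mem : ∀ {g} → mem g → mem (flip g)

module _ {n : ℕ} (Γ : Graph n) (G : PermGroup n) where
  open Graph Γ
  open PermGroup G

  IsAutGroup : Set
  IsAutGroup = ∀ g → mem g → ∀ x y → adj (g ⟨$⟩ʳ x) (g ⟨$⟩ʳ y) ≡ adj x y

  IsSymmetric : Set
  IsSymmetric =
      IsAutGroup
    × (∀ x y → ∃ λ g → mem g × g ⟨$⟩ʳ x ≡ y)
    × (∀ x y z w → adj x y ≡ true → adj z w ≡ true →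
         ∃ λ g → mem g × (g ⟨$⟩ʳ x ≡ z) × (g ⟨$⟩ʳ y ≡ w))

-- A partition of Fin n into p blocks, given by the block map blk.
-- Block j is { x | blk x ≡ j }.

module Partition {n p : ℕ} (Γ : Graph n) (blk : Fin n → Fin p) where
  open Graph Γ

  blockSize : Fin p → ℕ
  blockSize B = count (λ x → blk x == B)

  inΓ : Fin p → Fin n → Bool
  inΓ C α = anyF (λ y → adj α y ∧ (blk y == C))

  qadj : Fin p → Fin p → Bool
  qadj B C = not (B == C) ∧
             anyF (λ x → anyF (λ y → (blk x == B) ∧ (blk y == C) ∧ adj x y))

  kPar : Fin p → Fin p → ℕ
  kPar B C = count (λ α → (blk α == B) ∧ inΓ C α)

  rPar : Fin n → ℕ
  rPar α = count (λ C → inΓ C α)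

  bPar : Fin p → ℕ
  bPar B = count (λ C → qadj B C)

  sameTrace : Fin p → Fin p → Fin p → Bool
  sameTrace B C D = allF (λ α → (blk α == B) ⇒ᵇ (inΓ D α ⇔ᵇ inΓ C α))

  mPar : Fin p → Fin p → ℕ
  mPar B C = count (λ D → qadj B D ∧ sameTrace B C D)

  IsNontrivialInvariant : PermGroup n → Set
  IsNontrivialInvariant G =
      (∀ B → ∃ λ x → blk x ≡ B)
    × (∀ B → 1 < blockSize B × blockSize B < n)
    × (∀ g → PermGroup.mem G g → ∀ x y →
         blk x ≡ blk y → blk (g ⟨$⟩ʳ x) ≡ blk (g ⟨$⟩ʳ y))
    × (∃ λ B → ∃ λ C → qadj B C ≡ true)

-- Two blocks C, D ∈ Γ_B(B) are equivalent when Γ(C) ∩ B = Γ(D) ∩ B; the multiplicity m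
-- is the size of the equivalence class of C. An element of G mapping an arc from B to C
-- onto an arc from B to D fixes B and carries the class of C onto that of D, so by arc
-- transitivity every class has exactly m elements. Both Γ_B(B) and Γ_B(α) (for α ∈ B) are
-- unions of classes, hence their sizes b and r are multiples of m.
module Submission where

open import Defs
open import Data.Nat using (ℕ; _+_; _≤_)
open import Data.Nat.Divisibility using (_∣_)
open import Data.Fin using (Fin)
open import Data.Bool using (true)
open import Data.Product using (_×_)
open import Relation.Binary.PropositionalEquality using (_≡_)

import Data.Nat as ℕ
open import Data.Nat.Properties using (+-0-commutativeMonoid; +-suc; ≤-refl; ≤-trans; m<m+n)
open import Data.Nat.Divisibility using (_∣0; ∣m∣n⇒∣m+n; ∣-refl)
open import Data.Bool using (Bool; false; _∧_; _∨_; not; if_then_else_)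
open import Data.Bool.Properties using (∧-zeroʳ; ∧-identityʳ; not-injective; ∧-conicalˡ; ∧-conicalʳ; ∨-zeroʳ)
import Data.Fin as Fin
open import Data.Fin.Properties using (_≟_)
open import Data.Fin.Permutation using (Permutation′; permutation; _⟨$⟩ʳ_; inverseˡ; inverseʳ; flip)
open import Data.Product using (_,_; ∃; proj₁; proj₂)
open import Data.Sum using (_⊎_; inj₁; inj₂)
open import Data.Empty using (⊥-elim)
open import Function using (_∘_)
open import Relation.Nullary using (yes; no)
open import Relation.Binary.PropositionalEquality
  using (refl; sym; trans; cong; cong₂; subst; _≢_; module ≡-Reasoning)
open import Algebra.Properties.CommutativeMonoid.Sum +-0-commutativeMonoid using (sum; sum-permute)

indicator : Bool → ℕ
indicator b = if b then 1 else 0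

==⇒≡ : ∀ {n} {i j : Fin n} → (i == j) ≡ true → i ≡ j
==⇒≡ {i = i} {j} h with i ≟ j
... | yes i≡j = i≡j

≡⇒== : ∀ {n} {i j : Fin n} → i ≡ j → (i == j) ≡ true
≡⇒== {i = i} {j} i≡j with i ≟ j
... | yes _   = refl
... | no  i≢j = ⊥-elim (i≢j i≡j)

⇔ᵇ⇒≡ : ∀ {a b} → (a ⇔ᵇ b) ≡ true → a ≡ b
⇔ᵇ⇒≡ {false} {false} _ = refl
⇔ᵇ⇒≡ {true}  {true}  _ = refl

⇒ᵇ-mp : ∀ {a b} → a ≡ true → (a ⇒ᵇ b) ≡ true → b ≡ true
⇒ᵇ-mp refl h = h

⇒ᵇ-intro : ∀ {a b} → b ≡ true → (a ⇒ᵇ b) ≡ true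
⇒ᵇ-intro {a} refl = ∨-zeroʳ (not a)

⇔ᵇ-refl : ∀ a → (a ⇔ᵇ a) ≡ true
⇔ᵇ-refl false = refl
⇔ᵇ-refl true  = refl

true≢false : true ≢ false
true≢false ()

≡true-ext : ∀ {a b : Bool} → (a ≡ true → b ≡ true) → (b ≡ true → a ≡ true) → a ≡ b
≡true-ext {false} {false} _ _ = refl
≡true-ext {false} {true}  _ g = g refl
≡true-ext {true}  {false} f _ = sym (f refl)
≡true-ext {true}  {true}  _ _ = refl

∧-true : ∀ {a b} → a ≡ true → b ≡ true → a ∧ b ≡ true
∧-true refl refl = refl

anyF-true⁻ : ∀ {n} (f : Fin n → Bool) → anyF f ≡ true → ∃ λ i → f i ≡ true
anyF-true⁻ {ℕ.suc n} f h with f Fin.zero in e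
... | true  = Fin.zero , e
... | false with anyF-true⁻ (λ i → f (Fin.suc i)) h
...   | i , fi = Fin.suc i , fi

anyF-true⁺ : ∀ {n} (f : Fin n → Bool) (i : Fin n) → f i ≡ true → anyF f ≡ true
anyF-true⁺ f Fin.zero    fi rewrite fi = refl
anyF-true⁺ f (Fin.suc i) fi with f Fin.zero
... | true  = refl
... | false = anyF-true⁺ (λ j → f (Fin.suc j)) i fi

allF-true⁻ : ∀ {n} (f : Fin n → Bool) → allF f ≡ true → ∀ i → f i ≡ true
allF-true⁻ f h Fin.zero    = ∧-conicalˡ _ _ h
allF-true⁻ f h (Fin.suc i) = allF-true⁻ (λ j → f (Fin.suc j)) (∧-conicalʳ _ _ h) i

allF-true⁺ : ∀ {n} (f : Fin n → Bool) → (∀ i → f i ≡ true) → allF f ≡ true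
allF-true⁺ {ℕ.zero}  f h = refl
allF-true⁺ {ℕ.suc n} f h = ∧-true (h Fin.zero) (allF-true⁺ (λ j → f (Fin.suc j)) (λ j → h (Fin.suc j)))

anyF-cong : ∀ {n} {f g : Fin n → Bool} → (∀ i → f i ≡ g i) → anyF f ≡ anyF g
anyF-cong {ℕ.zero}  h = refl
anyF-cong {ℕ.suc n} h = cong₂ _∨_ (h Fin.zero) (anyF-cong (λ i → h (Fin.suc i)))

allF-cong : ∀ {n} {f g : Fin n → Bool} → (∀ i → f i ≡ g i) → allF f ≡ allF g
allF-cong {ℕ.zero}  h = refl
allF-cong {ℕ.suc n} h = cong₂ _∧_ (h Fin.zero) (allF-cong (λ i → h (Fin.suc i)))

count-cong : ∀ {n} {f g : Fin n → Bool} → (∀ i → f i ≡ g i) → count f ≡ count g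
count-cong {ℕ.zero}  h = refl
count-cong {ℕ.suc n} h = cong₂ (λ a c → indicator a + c) (h Fin.zero) (count-cong (λ i → h (Fin.suc i)))

anyF-reindex : ∀ {n} (f : Fin n → Bool) (s t : Fin n → Fin n) → (∀ i → s (t i) ≡ i) →
  anyF f ≡ anyF (f ∘ s)
anyF-reindex f s t st = ≡true-ext
  (λ h → let (i , fi) = anyF-true⁻ f h
         in anyF-true⁺ _ (t i) (subst (λ z → f z ≡ true) (sym (st i)) fi))
  (λ h → let (i , fsi) = anyF-true⁻ _ h in anyF-true⁺ f (s i) fsi)

allF-reindex : ∀ {n} (f : Fin n → Bool) (s t : Fin n → Fin n) → (∀ i → s (t i) ≡ i) →
  allF f ≡ allF (f ∘ s)
allF-reindex f s t st = ≡true-ext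
  (λ h → allF-true⁺ _ (λ j → allF-true⁻ f h (s j)))
  (λ h → allF-true⁺ f (λ i → subst (λ z → f z ≡ true) (st i) (allF-true⁻ _ h (t i))))

count≡sum : ∀ {n} (f : Fin n → Bool) → count f ≡ sum (indicator ∘ f)
count≡sum {ℕ.zero}  f = refl
count≡sum {ℕ.suc n} f = cong (indicator (f Fin.zero) +_) (count≡sum (λ i → f (Fin.suc i)))

count-permute : ∀ {n} (f : Fin n → Bool) (s t : Fin n → Fin n) →
  (∀ i → s (t i) ≡ i) → (∀ i → t (s i) ≡ i) → count f ≡ count (f ∘ s)
count-permute f s t st ts = begin
  count f                  ≡⟨ count≡sum f ⟩
  sum (indicator ∘ f)      ≡⟨ sum-permute _ (permutation s t st ts) ⟩
  sum (indicator ∘ f ∘ s)  ≡⟨ count≡sum (f ∘ s) ⟨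
  count (f ∘ s)            ∎
  where open ≡-Reasoning

count≡0⊎witness : ∀ {n} (f : Fin n → Bool) → count f ≡ 0 ⊎ ∃ λ i → f i ≡ true
count≡0⊎witness {ℕ.zero}  f = inj₁ refl
count≡0⊎witness {ℕ.suc n} f with f Fin.zero in e
... | true  = inj₂ (Fin.zero , e)
... | false with count≡0⊎witness (λ i → f (Fin.suc i))
...   | inj₁ c≡0      = inj₁ c≡0
...   | inj₂ (i , fi) = inj₂ (Fin.suc i , fi)

witness⇒count≥1 : ∀ {n} (f : Fin n → Bool) (i : Fin n) → f i ≡ true → 1 ≤ count f
witness⇒count≥1 f Fin.zero    fi rewrite fi = ℕ.s≤s ℕ.z≤n
witness⇒count≥1 f (Fin.suc i) fi with f Fin.zero
... | true  = ℕ.s≤s ℕ.z≤n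
... | false = witness⇒count≥1 (λ j → f (Fin.suc j)) i fi

count-split : ∀ {n} (f q : Fin n → Bool) →
  count f ≡ count (λ i → f i ∧ not (q i)) + count (λ i → f i ∧ q i)
count-split {ℕ.zero}  f q = refl
count-split {ℕ.suc n} f q
  rewrite count-split (λ i → f (Fin.suc i)) (λ i → q (Fin.suc i))
  with f Fin.zero | q Fin.zero
... | false | _     = refl
... | true  | false = refl
... | true  | true  = sym (+-suc _ _)

Saturated : ∀ {p} → (Fin p → Fin p → Bool) → (Fin p → Bool) → Set
Saturated E P = ∀ a b → P a ≡ true → E a b ≡ true → P b ≡ true

classSize : ∀ {p} → (Fin p → Fin p → Bool) → (Fin p → Bool) → Fin p → ℕ
classSize E P a = count (λ b → P b ∧ E a b)

-- E is reflexive and Euclidean, i.e. an equivalence relation.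
module ClassCounting {p : ℕ} (E : Fin p → Fin p → Bool)
  (E-refl : ∀ a → E a a ≡ true)
  (E-eucl : ∀ a b → E a b ≡ true → ∀ c → E a c ≡ E b c) where

  E-sym : ∀ a b → E a b ≡ true → E b a ≡ true
  E-sym a b ab = trans (sym (E-eucl a b ab a)) (E-refl a)

  E-separates : ∀ a b c → E a b ≡ false → E b c ≡ true → E a c ≡ false
  E-separates a b c ab bc with E a c in ac
  ... | false = refl
  ... | true  = trans (sym (trans (E-eucl a c ac b) (E-sym b c bc))) ab

  classSize-cong : ∀ {P Q} → Saturated E P → Saturated E Q →
    ∀ a → P a ≡ true → Q a ≡ true → classSize E P a ≡ classSize E Q a
  classSize-cong {P} {Q} P-sat Q-sat a Pa Qa = count-cong pointwise
    where
    pointwise : ∀ b → (P b ∧ E a b) ≡ (Q b ∧ E a b)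
    pointwise b with E a b in ab
    ... | false = trans (∧-zeroʳ (P b)) (sym (∧-zeroʳ (Q b)))
    ... | true  = cong (_∧ true) (trans (P-sat a b Pa ab) (sym (Q-sat a b Qa ab)))

  module _ (P : Fin p → Bool) (a : Fin p) where

    withoutClass : Fin p → Bool
    withoutClass b = P b ∧ not (E a b)

    withoutClass-saturated : Saturated E P → Saturated E withoutClass
    withoutClass-saturated P-sat b c P′b bc =
      ∧-true (P-sat b c (∧-conicalˡ _ _ P′b) bc)
             (cong not (E-separates a b c (not-injective (∧-conicalʳ _ _ P′b)) bc))

    withoutClass-classSize : ∀ b → E a b ≡ false → classSize E withoutClass b ≡ classSize E P b
    withoutClass-classSize b ab = count-cong pointwise
      where
      pointwise : ∀ c → (withoutClass c ∧ E b c) ≡ (P c ∧ E b c)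
      pointwise c with E b c in bc
      ... | false = trans (∧-zeroʳ (withoutClass c)) (sym (∧-zeroʳ (P c)))
      ... | true rewrite E-separates a b c ab bc = cong (_∧ true) (∧-identityʳ (P c))

    count-withoutClass : count P ≡ count withoutClass + classSize E P a
    count-withoutClass = count-split P (E a)

    classSize≥1 : P a ≡ true → 1 ≤ classSize E P a
    classSize≥1 Pa = witness⇒count≥1 _ a (∧-true Pa (E-refl a))

  classSize∣count : ∀ m P → Saturated E P → (∀ a → P a ≡ true → classSize E P a ≡ m) → m ∣ count P
  classSize∣count m P = peel (count P) P ≤-refl
    where
    peel : ∀ fuel P → count P ≤ fuel → Saturated E P →
      (∀ a → P a ≡ true → classSize E P a ≡ m) → m ∣ count P
    peel fuel P P≤fuel P-sat size with count≡0⊎witness P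
    ... | inj₁ P≡0 rewrite P≡0 = m ∣0
    peel ℕ.zero P P≤0 P-sat size | inj₂ (a , Pa) with ≤-trans (witness⇒count≥1 P a Pa) P≤0
    ... | ()
    peel (ℕ.suc fuel) P P≤fuel P-sat size | inj₂ (a , Pa) =
      subst (m ∣_) (sym count-P) (∣m∣n⇒∣m+n (peel fuel P′ P′≤fuel P′-sat size′) ∣-refl)
      where
      P′ = withoutClass P a
      P′-sat = withoutClass-saturated P a P-sat
      count-P : count P ≡ count P′ + m
      count-P = trans (count-withoutClass P a) (cong (count P′ +_) (size a Pa))
      P′≤fuel : count P′ ≤ fuel
      P′≤fuel = ℕ.≤-pred (≤-trans (m<m+n (count P′) (subst (1 ≤_) (size a Pa) (classSize≥1 P a Pa)))
                                  (subst (_≤ ℕ.suc fuel) count-P P≤fuel))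
      size′ : ∀ b → P′ b ≡ true → classSize E P′ b ≡ m
      size′ b P′b = trans (withoutClass-classSize P a b (not-injective (∧-conicalʳ _ _ P′b)))
                         (size b (∧-conicalˡ _ _ P′b))

module PartitionFacts {n p : ℕ} (Γ : Graph n) (blk : Fin n → Fin p) where
  open Graph Γ using (adj)
  open Partition Γ blk

  qadj⇒arc : ∀ {A E} → qadj A E ≡ true →
    A ≢ E × ∃ λ x → ∃ λ y → blk x ≡ A × blk y ≡ E × adj x y ≡ true
  qadj⇒arc {A} {E} h with anyF-true⁻ _ (∧-conicalʳ (not (A == E)) _ h)
  ... | x , hx with anyF-true⁻ _ hx
  ...   | y , hy =
    (λ A≡E → true≢false (trans (sym (∧-conicalˡ _ _ h)) (cong not (≡⇒== A≡E)))) ,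
    x , y , ==⇒≡ (∧-conicalˡ _ _ hy) , ==⇒≡ (∧-conicalˡ _ _ y∈E∧xy) , ∧-conicalʳ (blk y == E) _ y∈E∧xy
    where
    y∈E∧xy : ((blk y == E) ∧ adj x y) ≡ true
    y∈E∧xy = ∧-conicalʳ (blk x == A) _ hy

  inΓ⇒arc : ∀ {E α} → inΓ E α ≡ true → ∃ λ y → adj α y ≡ true × blk y ≡ E
  inΓ⇒arc {E} {α} h with anyF-true⁻ _ h
  ... | y , hy = y , ∧-conicalˡ _ _ hy , ==⇒≡ (∧-conicalʳ (adj α y) _ hy)

  arc⇒inΓ : ∀ {E α y} → adj α y ≡ true → blk y ≡ E → inΓ E α ≡ true
  arc⇒inΓ {y = y} αy y∈E = anyF-true⁺ _ y (∧-true αy (≡⇒== y∈E))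

  qadj⇒inΓ : ∀ {A E} → qadj A E ≡ true → ∃ λ x → blk x ≡ A × inΓ E x ≡ true
  qadj⇒inΓ h with qadj⇒arc h
  ... | _ , x , y , x∈A , y∈E , xy = x , x∈A , arc⇒inΓ xy y∈E

  sameTrace⇒inΓ≡ : ∀ {A C D} → sameTrace A C D ≡ true → ∀ α → blk α ≡ A → inΓ D α ≡ inΓ C α
  sameTrace⇒inΓ≡ h α α∈A = ⇔ᵇ⇒≡ (⇒ᵇ-mp (≡⇒== α∈A) (allF-true⁻ _ h α))

  sameTrace-refl : ∀ A C → sameTrace A C C ≡ true
  sameTrace-refl A C = allF-true⁺ _ (λ α → ⇒ᵇ-intro (⇔ᵇ-refl (inΓ C α)))

  sameTrace-eucl : ∀ A C D → sameTrace A C D ≡ true → ∀ E → sameTrace A C E ≡ sameTrace A D E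
  sameTrace-eucl A C D h E = allF-cong pointwise
    where
    pointwise : ∀ α → ((blk α == A) ⇒ᵇ (inΓ E α ⇔ᵇ inΓ C α)) ≡ ((blk α == A) ⇒ᵇ (inΓ E α ⇔ᵇ inΓ D α))
    pointwise α with blk α == A in α∈A
    ... | false = refl
    ... | true rewrite sameTrace⇒inΓ≡ h α (==⇒≡ α∈A) = refl

  inΓ-saturated : ∀ {A α} → blk α ≡ A → Saturated (sameTrace A) (λ E → inΓ E α)
  inΓ-saturated α∈A C D α∈ΓC CD = trans (sameTrace⇒inΓ≡ CD _ α∈A) α∈ΓC

  module _ (blocks-independent : ∀ x y → blk x ≡ blk y → adj x y ≡ false) where

    arc⇒qadj : ∀ {A E x y} → blk x ≡ A → blk y ≡ E → adj x y ≡ true → qadj A E ≡ true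
    arc⇒qadj {A} {E} {x} {y} x∈A y∈E xy with A == E in A==E
    ... | true  = ⊥-elim (true≢false (trans (sym xy)
                    (blocks-independent x y (trans x∈A (trans (==⇒≡ A==E) (sym y∈E))))))
    ... | false = anyF-true⁺ _ x (anyF-true⁺ _ y (∧-true (≡⇒== x∈A) (∧-true (≡⇒== y∈E) xy)))

    inΓ⇒qadj : ∀ {A E α} → blk α ≡ A → inΓ E α ≡ true → qadj A E ≡ true
    inΓ⇒qadj α∈A h with inΓ⇒arc h
    ... | y , αy , y∈E = arc⇒qadj α∈A y∈E αy

    qadj-saturated : ∀ {A} → Saturated (sameTrace A) (qadj A)
    qadj-saturated C D AC CD with qadj⇒inΓ AC
    ... | x , x∈A , x∈ΓC = inΓ⇒qadj x∈A (inΓ-saturated x∈A C D x∈ΓC CD)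

module BlockAction {n p : ℕ} (Γ : Graph n) (blk : Fin n → Fin p)
  (representative : ∀ E → ∃ λ x → blk x ≡ E)
  (g : Permutation′ n)
  (g-aut : ∀ x y → Graph.adj Γ (g ⟨$⟩ʳ x) (g ⟨$⟩ʳ y) ≡ Graph.adj Γ x y)
  (g-blk : ∀ x y → blk x ≡ blk y → blk (g ⟨$⟩ʳ x) ≡ blk (g ⟨$⟩ʳ y))
  (g⁻¹-blk : ∀ x y → blk x ≡ blk y → blk (flip g ⟨$⟩ʳ x) ≡ blk (flip g ⟨$⟩ʳ y)) where
  open Partition Γ blk

  σ σ⁻¹ : Fin p → Fin p
  σ   E = blk (g ⟨$⟩ʳ proj₁ (representative E))
  σ⁻¹ E = blk (flip g ⟨$⟩ʳ proj₁ (representative E))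

  σ-blk : ∀ x → blk (g ⟨$⟩ʳ x) ≡ σ (blk x)
  σ-blk x = g-blk x _ (sym (proj₂ (representative (blk x))))

  σ⁻¹-blk : ∀ x → blk (flip g ⟨$⟩ʳ x) ≡ σ⁻¹ (blk x)
  σ⁻¹-blk x = g⁻¹-blk x _ (sym (proj₂ (representative (blk x))))

  σ∘σ⁻¹ : ∀ E → σ (σ⁻¹ E) ≡ E
  σ∘σ⁻¹ E = begin
    σ (σ⁻¹ E)                      ≡⟨ σ-blk (flip g ⟨$⟩ʳ x) ⟨
    blk (g ⟨$⟩ʳ (flip g ⟨$⟩ʳ x))    ≡⟨ cong blk (inverseʳ g) ⟩
    blk x                          ≡⟨ proj₂ (representative E) ⟩
    E                              ∎
    where open ≡-Reasoning
          x = proj₁ (representative E)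

  σ⁻¹∘σ : ∀ E → σ⁻¹ (σ E) ≡ E
  σ⁻¹∘σ E = begin
    σ⁻¹ (σ E)                      ≡⟨ σ⁻¹-blk (g ⟨$⟩ʳ x) ⟨
    blk (flip g ⟨$⟩ʳ (g ⟨$⟩ʳ x))    ≡⟨ cong blk (inverseˡ g) ⟩
    blk x                          ≡⟨ proj₂ (representative E) ⟩
    E                              ∎
    where open ≡-Reasoning
          x = proj₁ (representative E)

  σ-== : ∀ A E → (σ A == σ E) ≡ (A == E)
  σ-== A E = ≡true-ext
    (λ h → ≡⇒== (trans (sym (σ⁻¹∘σ A)) (trans (cong σ⁻¹ (==⇒≡ h)) (σ⁻¹∘σ E))))
    (λ h → ≡⇒== (cong σ (==⇒≡ h)))

  blk-==-σ : ∀ x E → (blk (g ⟨$⟩ʳ x) == σ E) ≡ (blk x == E)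
  blk-==-σ x E = trans (cong (_== σ E) (σ-blk x)) (σ-== (blk x) E)

  g∘g⁻¹ : ∀ x → g ⟨$⟩ʳ (flip g ⟨$⟩ʳ x) ≡ x
  g∘g⁻¹ x = inverseʳ g

  inΓ-σ : ∀ E α → inΓ (σ E) (g ⟨$⟩ʳ α) ≡ inΓ E α
  inΓ-σ E α = trans (anyF-reindex _ (g ⟨$⟩ʳ_) (flip g ⟨$⟩ʳ_) g∘g⁻¹)
    (anyF-cong λ y → cong₂ _∧_ (g-aut α y) (blk-==-σ y E))

  qadj-σ : ∀ A E → qadj (σ A) (σ E) ≡ qadj A E
  qadj-σ A E = cong₂ _∧_ (cong not (σ-== A E))
    (trans (anyF-reindex _ (g ⟨$⟩ʳ_) (flip g ⟨$⟩ʳ_) g∘g⁻¹) (anyF-cong λ x →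
      trans (anyF-reindex _ (g ⟨$⟩ʳ_) (flip g ⟨$⟩ʳ_) g∘g⁻¹) (anyF-cong λ y →
        cong₂ _∧_ (blk-==-σ x A) (cong₂ _∧_ (blk-==-σ y E) (g-aut x y)))))

  sameTrace-σ : ∀ A C E → sameTrace (σ A) (σ C) (σ E) ≡ sameTrace A C E
  sameTrace-σ A C E = trans (allF-reindex _ (g ⟨$⟩ʳ_) (flip g ⟨$⟩ʳ_) g∘g⁻¹)
    (allF-cong λ α → cong₂ _⇒ᵇ_ (blk-==-σ α A) (cong₂ _⇔ᵇ_ (inΓ-σ E α) (inΓ-σ C α)))

module Symmetric {n p : ℕ} (Γ : Graph n) (G : PermGroup n) (blk : Fin n → Fin p)
  (symmetric : IsSymmetric Γ G) (invariant : Partition.IsNontrivialInvariant Γ blk G) where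
  open Graph Γ using (adj)
  open PermGroup G using (mem; inv-mem)
  open Partition Γ blk
  open PartitionFacts Γ blk

  private
    G≤AutΓ = proj₁ symmetric
    arc-transitive = proj₂ (proj₂ symmetric)
    representative = proj₁ invariant
    G-preserves-blocks = proj₁ (proj₂ (proj₂ invariant))
    quotient-edge = proj₂ (proj₂ (proj₂ invariant))

  module Action {g} (g∈G : mem g) = BlockAction Γ blk representative g
    (G≤AutΓ g g∈G) (G-preserves-blocks g g∈G) (G-preserves-blocks (flip g) (inv-mem g∈G))

  -- An arc inside a block could be mapped onto an arc of Γ joining two different blocks.
  blocks-independent : ∀ x y → blk x ≡ blk y → adj x y ≡ false
  blocks-independent x y x~y with adj x y in xy
  ... | false = refl
  ... | true with quotient-edge
  ...   | B₀ , C₀ , B₀C₀ with qadj⇒arc B₀C₀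
  ...     | B₀≢C₀ , x₀ , y₀ , x₀∈B₀ , y₀∈C₀ , x₀y₀ with arc-transitive x y x₀ y₀ xy x₀y₀
  ...       | g , g∈G , gx≡x₀ , gy≡y₀ = ⊥-elim (B₀≢C₀ (begin
    B₀               ≡⟨ x₀∈B₀ ⟨
    blk x₀           ≡⟨ cong blk gx≡x₀ ⟨
    blk (g ⟨$⟩ʳ x)   ≡⟨ G-preserves-blocks g g∈G x y x~y ⟩
    blk (g ⟨$⟩ʳ y)   ≡⟨ cong blk gy≡y₀ ⟩
    blk y₀           ≡⟨ y₀∈C₀ ⟩
    C₀               ∎))
    where open ≡-Reasoning

  mPar-constant : ∀ {B C D} → qadj B C ≡ true → qadj B D ≡ true → mPar B D ≡ mPar B C
  mPar-constant {B} {C} {D} BC BD with qadj⇒arc BC | qadj⇒arc BD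
  ... | _ , x , y , x∈B , y∈C , xy | _ , x′ , y′ , x′∈B , y′∈D , x′y′
    with arc-transitive x y x′ y′ xy x′y′
  ... | g , g∈G , gx≡x′ , gy≡y′ = trans (count-permute _ σ σ⁻¹ σ∘σ⁻¹ σ⁻¹∘σ) (count-cong pointwise)
    where
    open Action g∈G
    σB≡B : σ B ≡ B
    σB≡B = trans (cong σ (sym x∈B)) (trans (sym (σ-blk x)) (trans (cong blk gx≡x′) x′∈B))
    σC≡D : σ C ≡ D
    σC≡D = trans (cong σ (sym y∈C)) (trans (sym (σ-blk y)) (trans (cong blk gy≡y′) y′∈D))
    pointwise : ∀ E → (qadj B (σ E) ∧ sameTrace B D (σ E)) ≡ (qadj B E ∧ sameTrace B C E)
    pointwise E = trans (cong₂ (λ X Y → qadj X (σ E) ∧ sameTrace X Y (σ E)) (sym σB≡B) (sym σC≡D))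
                        (cong₂ _∧_ (qadj-σ B E) (sameTrace-σ B C E))

  module _ {B C : Fin p} (BC : qadj B C ≡ true) where
    open ClassCounting (sameTrace B) (sameTrace-refl B) (sameTrace-eucl B)

    mPar∣bPar : mPar B C ∣ bPar B
    mPar∣bPar = classSize∣count (mPar B C) (qadj B) (qadj-saturated blocks-independent)
      (λ D BD → mPar-constant BC BD)

    mPar∣rPar : ∀ {α} → blk α ≡ B → mPar B C ∣ rPar α
    mPar∣rPar {α} α∈B = classSize∣count (mPar B C) (λ E → inΓ E α) (inΓ-saturated α∈B)
      (λ D α∈ΓD → let BD = inΓ⇒qadj blocks-independent α∈B α∈ΓD in
        trans (classSize-cong (inΓ-saturated α∈B) (qadj-saturated blocks-independent) D α∈ΓD BD)
              (mPar-constant BC BD))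

lemma3p1 : ∀ {n p : ℕ} (Γ : Graph n) (G : PermGroup n) (blk : Fin n → Fin p) →
    IsSymmetric Γ G →
    Partition.IsNontrivialInvariant Γ blk G →
    ∀ (B C : Fin p) → Partition.qadj Γ blk B C ≡ true →
    ∀ (i : ℕ) → 1 ≤ i → Partition.kPar Γ blk B C + i ≡ Partition.blockSize Γ blk B →
    ∀ (α : Fin n) → blk α ≡ B →
    (Partition.mPar Γ blk B C ∣ Partition.rPar Γ blk α)
      × (Partition.mPar Γ blk B C ∣ Partition.bPar Γ blk B)
lemma3p1 Γ G blk symmetric invariant B C BC _ _ _ α α∈B = mPar∣rPar BC α∈B , mPar∣bPar BC
  where open Symmetric Γ G blk symmetric invariant
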